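{- For all positive integers $d, n$, there is a subset $U \subseteq \mathbb{Z}_3^n$ such that the subgraph of $H(n,3)$ induced by $U$ has maximum degree at most $d$, $|U| \ge 3^{n-1} + 3^{\lfloor (d-1)n/d \rfloor}$, and $U$ is disjoint from some maximum size independent set of $H(n,3)$.
   Context: $H(n,3)$ is the Hamming graph on $\mathbb{Z}_3^n$ (vertices adjacent iff they differ in exactly one coordinate); a maximum size independent set is an independent set of largest cardinality. -}

module Defs where

open import Data.Nat using (ℕ; zero; suc; _+_; _≤_)
open import Data.Fin using (Fin)
open import Data.Fin.Properties using () renaming (_≟_ to _≟ᶠ_)
open import Data.Vec using (Vec; []; _∷_)
open import Data.List using (List; length; filter)
open import Data.List.Relation.Unary.All using (All)
open import Data.List.Relation.Unary.Unique.Propositional using (Unique)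
open import Data.List.Membership.Propositional using (_∈_)
open import Relation.Nullary using (¬_; Dec; yes; no)
open import Relation.Nullary.Decidable using (¬?)
open import Relation.Binary.PropositionalEquality using (_≡_)
open import Data.Nat.Properties using () renaming (_≟_ to _≟ℕ_)
open import Data.Product using (_×_)

Word : ℕ → Set
Word n = Vec (Fin 3) n

dist : ∀ {n} → Word n → Word n → ℕ
dist {zero}  [] [] = 0
dist {suc n} (a ∷ x) (b ∷ y) with a ≟ᶠ b
... | yes _ = dist x y
... | no _  = suc (dist x y)

Adj : ∀ {n} → Word n → Word n → Set
Adj x y = dist x y ≡ 1

adj? : ∀ {n} (x y : Word n) → Dec (Adj x y)
adj? x y = dist x y ≟ℕ 1

-- A finite vertex set is represented by a duplicate-free list; |U| = length.
-- Degree of v in the subgraph induced by U: number of neighbours of v in U.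
degIn : ∀ {n} → List (Word n) → Word n → ℕ
degIn U v = length (filter (adj? v) U)

MaxDegAtMost : ∀ {n} → ℕ → List (Word n) → Set
MaxDegAtMost d U = All (λ v → degIn U v ≤ d) U

IsIndependent : ∀ {n} → List (Word n) → Set
IsIndependent {n} I = Unique I × (∀ {x y : Word n} → x ∈ I → y ∈ I → ¬ Adj x y)

IsMaxIndependent : ∀ {n} → List (Word n) → Set
IsMaxIndependent {n} I =
  IsIndependent I × (∀ (J : List (Word n)) → IsIndependent J → length J ≤ length I)

Disjoint : ∀ {n} → List (Word n) → List (Word n) → Set
Disjoint {n} U I = ∀ {x : Word n} → x ∈ U → ¬ (x ∈ I)

-- The residue (sum of the letters) of a word changes along every edge of H(n,3), so the
-- zero-residue class I is independent; it is maximum because the three words with a given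
-- tail form a triangle. Write n = (r + 1) + j d with r < d. In ℤ₃^(r+1) the complement of I
-- has degree r + 1 ≤ d, since every word outside I has exactly one neighbour outside I per
-- coordinate. Then glue j blocks of d letters in front, U ↦ (I × U) ∪ (Iᶜ × I): both parts
-- avoid I, a word of I × U keeps only its neighbours in U, and a word of Iᶜ × I has exactly
-- one neighbour per letter of its block. Counting shows that each gluing multiplies the
-- surplus |U| − 3^(length − 1) by 3^(d−1), so it grows from 3^r to 3^(r + j(d−1)), and
-- r + j(d − 1) ≥ ⌊(d − 1) n / d⌋.
{-# OPTIONS --safe #-}
module Submission where

open import Defs
open import Data.Nat using (ℕ; suc; _+_; _*_; _∸_; _^_; _/_; _≤_; NonZero)
open import Data.List using (List; length)
open import Data.List.Relation.Unary.Unique.Propositional using (Unique)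
open import Data.Product using (Σ; _×_)

open import Data.Product using (_,_; proj₂)

open import Function using (_∘_; id)
open import Function.Bundles using (Equivalence)
open import Data.Empty using (⊥)
open import Data.Unit using (tt)
open import Data.Bool using (Bool; true; false; not; _∧_; if_then_else_)
open import Data.Bool.Properties using (T-≡; ¬-not; not-injective; ∧-zeroʳ) renaming (_≟_ to _≟ᵇ_)
open import Data.Nat using (zero; _≡ᵇ_; _%_; z≤n; s≤s)
open import Data.Nat.Properties
  using ( +-identityʳ; +-comm; *-identityˡ; *-identityʳ; *-zeroʳ; +-suc; suc-injective
        ; +-assoc; ≤-refl; ≤-trans; ≤-reflexive; ≤-pred; +-monoʳ-≤; +-monoˡ-≤; *-monoʳ-≤; ^-monoʳ-≤
        ; ^-distribˡ-+-*; m<n+m; module ≤-Reasoning)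
open import Data.Nat.DivMod using (m≡m%n+[m/n]*n; m%n<n; m<n*o⇒m/o<n)
open import Data.Nat.ListAction using (sum)
open import Data.Nat.ListAction.Properties using (sum-++)
open import Data.Nat.Tactic.RingSolver using (solve-∀)
open import Data.Fin using (Fin)
open import Data.Fin.Patterns using (0F; 1F; 2F)
open import Data.Fin.Properties using (_≟_; all?)
open import Data.Vec using (Vec; []; _∷_; _++_; tail; take; drop)
open import Data.Vec.Properties using (∷-injective; take++drop≡id)
open import Data.List using ([]; _∷_; [_]; map; filter; filterᵇ; allFin; cartesianProductWith)
  renaming (_++_ to _++ₗ_)
open import Data.List.Properties using (map-++; map-∘; length-map; length-++; filter-all)
open import Data.List.Membership.Propositional using (_∈_)
open import Data.List.Membership.Propositional.Properties
  using (∈-filter⁻; ∈-cartesianProductWith⁺; ∈-allFin; ∈-∃++; ∈-++⁻; ∈-++⁺ˡ; ∈-++⁺ʳ)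
open import Data.List.Relation.Unary.Any using (here; there)
import Data.List.Relation.Unary.All as All
import Data.List.Relation.Unary.All.Properties as All
import Data.List.Relation.Unary.Unique.Propositional.Properties as Unique
open import Data.List.Relation.Unary.AllPairs using ([]; _∷_)
open import Data.Sum using (inj₁; inj₂)
open import Relation.Nullary using (contradiction; does; yes; no)
open import Relation.Nullary.Decidable using (from-yes; _→-dec_; ¬?; T?)
open import Relation.Unary using (Decidable)
open import Relation.Binary.PropositionalEquality
  using (_≡_; _≢_; refl; sym; trans; cong; cong₂; subst; subst₂; module ≡-Reasoning)

toℕ : Bool → ℕ
toℕ false = 0
toℕ true  = 1

take-++ : ∀ {A : Set} {g m} (w : Vec A g) (y : Vec A m) → take g (w ++ y) ≡ w
take-++ []      y = refl
take-++ (a ∷ w) y = cong (a ∷_) (take-++ w y)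

drop-++ : ∀ {A : Set} {g m} (w : Vec A g) (y : Vec A m) → drop g (w ++ y) ≡ y
drop-++ []      y = refl
drop-++ (a ∷ w) y = drop-++ w y

length-filterᵇ : ∀ {A : Set} (p : A → Bool) xs → length (filterᵇ p xs) ≡ sum (map (toℕ ∘ p) xs)
length-filterᵇ p []       = refl
length-filterᵇ p (x ∷ xs) with p x
... | true  = cong suc (length-filterᵇ p xs)
... | false = length-filterᵇ p xs

length-filter-filterᵇ : ∀ {A : Set} {R : A → Set} (R? : Decidable R) (p : A → Bool) xs →
  length (filter R? (filterᵇ p xs)) ≡ sum (map (λ x → toℕ (does (R? x) ∧ p x)) xs)
length-filter-filterᵇ R? p []       = refl
length-filter-filterᵇ R? p (x ∷ xs) with p x
... | false rewrite ∧-zeroʳ (does (R? x)) = length-filter-filterᵇ R? p xs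
... | true with does (R? x)
...   | false = length-filter-filterᵇ R? p xs
...   | true  = cong suc (length-filter-filterᵇ R? p xs)

sum-map-cartesianProductWith : ∀ {A B C : Set} (g : A → B → C) (f : C → ℕ) xs ys →
  sum (map f (cartesianProductWith g xs ys)) ≡ sum (map (λ x → sum (map (f ∘ g x) ys)) xs)
sum-map-cartesianProductWith g f []       ys = refl
sum-map-cartesianProductWith g f (x ∷ xs) ys = begin
  sum (map f (map (g x) ys ++ₗ cartesianProductWith g xs ys))
    ≡⟨ cong sum (map-++ f (map (g x) ys) _) ⟩
  sum (map f (map (g x) ys) ++ₗ map f (cartesianProductWith g xs ys))
    ≡⟨ sum-++ (map f (map (g x) ys)) _ ⟩
  sum (map f (map (g x) ys)) + sum (map f (cartesianProductWith g xs ys))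
    ≡⟨ cong₂ _+_ (cong sum (sym (map-∘ ys))) (sum-map-cartesianProductWith g f xs ys) ⟩
  sum (map (f ∘ g x) ys) + sum (map (λ x → sum (map (f ∘ g x) ys)) xs) ∎
  where open ≡-Reasoning

unique⇒length≤ : ∀ {A : Set} {xs ys : List A} → Unique xs → (∀ {x} → x ∈ xs → x ∈ ys) →
  length xs ≤ length ys
unique⇒length≤ {xs = []}     _            _     = z≤n
unique⇒length≤ {xs = x ∷ xs} (x∉xs ∷ !xs) xs⊆ys with ∈-∃++ (xs⊆ys (here refl))
... | us , vs , refl = begin
  suc (length xs)                  ≤⟨ s≤s (unique⇒length≤ !xs xs⊆us++vs) ⟩
  suc (length (us ++ₗ vs))         ≡⟨ cong suc (length-++ us) ⟩
  suc (length us + length vs)      ≡⟨ sym (+-suc (length us) (length vs)) ⟩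
  length us + length (x ∷ vs)      ≡⟨ sym (length-++ us) ⟩
  length (us ++ₗ [ x ] ++ₗ vs)     ∎
  where
  open ≤-Reasoning
  xs⊆us++vs : ∀ {y} → y ∈ xs → y ∈ us ++ₗ vs
  xs⊆us++vs y∈xs with ∈-++⁻ us (xs⊆ys (there y∈xs))
  ... | inj₁ y∈us          = ∈-++⁺ˡ y∈us
  ... | inj₂ (here refl)   = contradiction refl (All.lookup x∉xs y∈xs)
  ... | inj₂ (there y∈vs)  = ∈-++⁺ʳ us y∈vs

-- ℤ₃

infixl 6 _⊕_
_⊕_ : Fin 3 → Fin 3 → Fin 3
0F ⊕ b  = b
1F ⊕ 0F = 1F
1F ⊕ 1F = 2F
1F ⊕ 2F = 0F
2F ⊕ 0F = 2F
2F ⊕ 1F = 0F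
2F ⊕ 2F = 1F

isZero : Fin 3 → Bool
isZero 0F = true
isZero 1F = false
isZero 2F = false

⊕-assoc : ∀ a b c → a ⊕ b ⊕ c ≡ a ⊕ (b ⊕ c)
⊕-assoc = from-yes (all? λ a → all? λ b → all? λ c → a ⊕ b ⊕ c ≟ a ⊕ (b ⊕ c))

⊕-shift : ∀ a k σ → a ⊕ k ⊕ σ ≡ a ⊕ (σ ⊕ k)
⊕-shift = from-yes (all? λ a → all? λ k → all? λ σ → a ⊕ k ⊕ σ ≟ a ⊕ (σ ⊕ k))

⊕-cancelˡ : ∀ a b c → a ⊕ b ≡ a ⊕ c → b ≡ c
⊕-cancelˡ = from-yes (all? λ a → all? λ b → all? λ c → (a ⊕ b ≟ a ⊕ c) →-dec (b ≟ c))

⊕-cancelʳ : ∀ a b c → a ⊕ c ≡ b ⊕ c → a ≡ b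
⊕-cancelʳ = from-yes (all? λ a → all? λ b → all? λ c → (a ⊕ c ≟ b ⊕ c) →-dec (a ≟ b))

a≢a⊕k : ∀ a k → isZero k ≡ false → a ≢ a ⊕ k
a≢a⊕k = from-yes (all? λ a → all? λ k → (isZero k ≟ᵇ false) →-dec ¬? (a ≟ a ⊕ k))

isZero-⊕ : ∀ s t → isZero (s ⊕ t) ≡ true → isZero s ≡ isZero t
isZero-⊕ = from-yes (all? λ s → all? λ t → (isZero (s ⊕ t) ≟ᵇ true) →-dec (isZero s ≟ᵇ isZero t))

isZero⇒≡0F : ∀ {σ} → isZero σ ≡ true → σ ≡ 0F
isZero⇒≡0F {0F} _  = refl
isZero⇒≡0F {1F} ()
isZero⇒≡0F {2F} ()

∑₃ : (Fin 3 → ℕ) → ℕ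
∑₃ h = h 0F + h 1F + h 2F

∑₃-cong : ∀ {h k : Fin 3 → ℕ} → (∀ a → h a ≡ k a) → ∑₃ h ≡ ∑₃ k
∑₃-cong h≗k = cong₂ _+_ (cong₂ _+_ (h≗k 0F) (h≗k 1F)) (h≗k 2F)

+-rotate : ∀ x y z → x + y + z ≡ y + z + x
+-rotate = solve-∀

∑₃-from : ∀ a (h : Fin 3 → ℕ) → ∑₃ h ≡ h a + h (a ⊕ 1F) + h (a ⊕ 2F)
∑₃-from 0F h = refl
∑₃-from 1F h = +-rotate (h 0F) (h 1F) (h 2F)
∑₃-from 2F h = sym (+-rotate (h 2F) (h 0F) (h 1F))

∑₃-translate : ∀ a (h : Fin 3 → ℕ) → ∑₃ (λ b → h (a ⊕ b)) ≡ ∑₃ h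
∑₃-translate 0F h = refl
∑₃-translate 1F h = sym (+-rotate (h 0F) (h 1F) (h 2F))
∑₃-translate 2F h = +-rotate (h 2F) (h 0F) (h 1F)

-- Changing one letter of a word shifts its residue by 1F or by 2F.
shiftsInto : (Fin 3 → Bool) → Fin 3 → ℕ
shiftsInto Q σ = toℕ (Q (σ ⊕ 1F)) + toℕ (Q (σ ⊕ 2F))

shiftsInto-translate : ∀ Q a σ → shiftsInto (Q ∘ (a ⊕_)) σ ≡ shiftsInto Q (a ⊕ σ)
shiftsInto-translate Q a σ =
  cong₂ (λ s t → toℕ (Q s) + toℕ (Q t)) (sym (⊕-assoc a σ 1F)) (sym (⊕-assoc a σ 2F))

shiftsInto-isZero : ∀ (q : Bool → Bool) σ →
  shiftsInto (q ∘ isZero) σ ≡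
    (if isZero σ then toℕ (q false) + toℕ (q false) else toℕ (q true) + toℕ (q false))
shiftsInto-isZero q 0F = refl
shiftsInto-isZero q 1F = +-comm (toℕ (q false)) (toℕ (q true))
shiftsInto-isZero q 2F = refl

residue : ∀ {n} → Word n → Fin 3
residue []      = 0F
residue (a ∷ x) = a ⊕ residue x

residue-++ : ∀ {g m} (w : Word g) (y : Word m) → residue (w ++ y) ≡ residue w ⊕ residue y
residue-++ []      y = refl
residue-++ (a ∷ w) y =
  trans (cong (a ⊕_) (residue-++ w y)) (sym (⊕-assoc a (residue w) (residue y)))

++-elim : ∀ g {m} (P : Word (g + m) → Set) → (∀ w y → P (w ++ y)) → ∀ x → P x
++-elim g P P[w++y] x = subst P (take++drop≡id g x) (P[w++y] (take g x) (drop g x))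

dist-∷-same : ∀ {n} a (x y : Word n) → dist (a ∷ x) (a ∷ y) ≡ dist x y
dist-∷-same a x y with a ≟ a
... | yes _   = refl
... | no  a≢a = contradiction refl a≢a

dist-∷-≢ : ∀ {n a b} {x y : Word n} → a ≢ b → dist (a ∷ x) (b ∷ y) ≡ suc (dist x y)
dist-∷-≢ {a = a} {b} a≢b with a ≟ b
... | yes a≡b = contradiction a≡b a≢b
... | no  _   = refl

dist-refl : ∀ {n} (x : Word n) → dist x x ≡ 0
dist-refl []      = refl
dist-refl (a ∷ x) = trans (dist-∷-same a x x) (dist-refl x)

dist≡0⇒≡ : ∀ {n} (x y : Word n) → dist x y ≡ 0 → x ≡ y
dist≡0⇒≡ []      []      _ = refl
dist≡0⇒≡ (a ∷ x) (b ∷ y) d≡0 with a ≟ b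
... | yes refl = cong (a ∷_) (dist≡0⇒≡ x y d≡0)
dist≡0⇒≡ (a ∷ x) (b ∷ y) () | no _

adjacent⇒residue≢ : ∀ {n} (x y : Word n) → Adj x y → residue x ≢ residue y
adjacent⇒residue≢ [] [] ()
adjacent⇒residue≢ (a ∷ x) (b ∷ y) adj with a ≟ b
... | yes refl = adjacent⇒residue≢ x y adj ∘ ⊕-cancelˡ a (residue x) (residue y)
... | no  a≢b with dist≡0⇒≡ x y (suc-injective adj)
...   | refl = a≢b ∘ ⊕-cancelʳ a b (residue x)

sameTail⇒adjacent : ∀ {n} {x y : Word (suc n)} → x ≢ y → tail x ≡ tail y → Adj x y
sameTail⇒adjacent {x = a ∷ x} {b ∷ .x} x≢y refl =
  trans (dist-∷-≢ (λ a≡b → x≢y (cong (_∷ x) a≡b))) (cong suc (dist-refl x))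

-- Counting vertex sets and degrees

WordSet : ℕ → Set
WordSet n = Word n → Bool

zeroSum : ∀ {n} → WordSet n
zeroSum x = isZero (residue x)

nonZeroSum : ∀ {n} → WordSet n
nonZeroSum = not ∘ zeroSum

sumWords : ∀ n → (Word n → ℕ) → ℕ
sumWords zero    f = f []
sumWords (suc n) f = ∑₃ λ a → sumWords n (λ y → f (a ∷ y))

count : ∀ {n} → WordSet n → ℕ
count {n} P = sumWords n (toℕ ∘ P)

sumWords-cong : ∀ n {f h : Word n → ℕ} → (∀ x → f x ≡ h x) → sumWords n f ≡ sumWords n h
sumWords-cong zero    f≗h = f≗h []
sumWords-cong (suc n) f≗h = ∑₃-cong λ a → sumWords-cong n (λ y → f≗h (a ∷ y))

triple : ∀ y z → y * z + y * z + y * z ≡ 3 * y * z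
triple = solve-∀

sumWords-const : ∀ n k → sumWords n (λ _ → k) ≡ 3 ^ n * k
sumWords-const zero    k = sym (*-identityˡ k)
sumWords-const (suc n) k = trans (cong (λ s → s + s + s) (sumWords-const n k)) (triple (3 ^ n) k)

sumWords-++ : ∀ g m (f : Word (g + m) → ℕ) →
  sumWords (g + m) f ≡ sumWords g (λ w → sumWords m (λ y → f (w ++ y)))
sumWords-++ zero    m f = refl
sumWords-++ (suc g) m f = ∑₃-cong λ a → sumWords-++ g m (λ x → f (a ∷ x))

sumWords-if : ∀ n (P : WordSet n) A B →
  sumWords n (λ x → if P x then A else B) ≡ count P * A + count (not ∘ P) * B
sumWords-if zero P A B with P []
... | true  = sym (trans (+-identityʳ _) (+-identityʳ A))
... | false = sym (+-identityʳ B)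
sumWords-if (suc n) P A B =
  trans (∑₃-cong λ a → sumWords-if n (λ y → P (a ∷ y)) A B)
        (linear (c 0F) (c 1F) (c 2F) (c̄ 0F) (c̄ 1F) (c̄ 2F) A B)
  where
  c c̄ : Fin 3 → ℕ
  c  a = count (λ y → P (a ∷ y))
  c̄ a = count (λ y → not (P (a ∷ y)))
  linear : ∀ c₀ c₁ c₂ c̄₀ c̄₁ c̄₂ A B →
    c₀ * A + c̄₀ * B + (c₁ * A + c̄₁ * B) + (c₂ * A + c̄₂ * B) ≡
    (c₀ + c₁ + c₂) * A + (c̄₀ + c̄₁ + c̄₂) * B
  linear = solve-∀

sumWords-residue : ∀ n (f : Fin 3 → ℕ) → sumWords (suc n) (f ∘ residue) ≡ 3 ^ n * ∑₃ f
sumWords-residue zero    f = sym (*-identityˡ (∑₃ f))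
sumWords-residue (suc n) f = begin
  ∑₃ (λ a → sumWords (suc n) ((f ∘ (a ⊕_)) ∘ residue))
    ≡⟨ ∑₃-cong (λ a → sumWords-residue n (f ∘ (a ⊕_))) ⟩
  ∑₃ (λ a → 3 ^ n * ∑₃ (f ∘ (a ⊕_)))
    ≡⟨ ∑₃-cong (λ a → cong (3 ^ n *_) (∑₃-translate a f)) ⟩
  ∑₃ (λ _ → 3 ^ n * ∑₃ f)
    ≡⟨ triple (3 ^ n) (∑₃ f) ⟩
  3 ^ suc n * ∑₃ f ∎
  where open ≡-Reasoning

count-zeroSum : ∀ n → count (zeroSum {suc n}) ≡ 3 ^ n
count-zeroSum n = trans (sumWords-residue n (toℕ ∘ isZero)) (*-identityʳ (3 ^ n))

count-nonZeroSum : ∀ n → count (nonZeroSum {suc n}) ≡ 3 ^ n * 2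
count-nonZeroSum n = sumWords-residue n (toℕ ∘ not ∘ isZero)

-- a ⊕ 1F and a ⊕ 2F are the two letters different from a.
degree : ∀ {n} → WordSet n → Word n → ℕ
degree {zero}  P []      = 0
degree {suc n} P (a ∷ v) =
  degree (λ y → P (a ∷ y)) v + toℕ (P (a ⊕ 1F ∷ v)) + toℕ (P (a ⊕ 2F ∷ v))

MaxDegree : ∀ {n} → ℕ → WordSet n → Set
MaxDegree D P = ∀ x → P x ≡ true → degree P x ≤ D

degree-cong : ∀ {n} {P Q : WordSet n} → (∀ x → P x ≡ Q x) → ∀ v → degree P v ≡ degree Q v
degree-cong {zero}  P≗Q []      = refl
degree-cong {suc n} P≗Q (a ∷ v) =
  cong₂ _+_ (cong₂ _+_ (degree-cong (λ y → P≗Q (a ∷ y)) v) (cong toℕ (P≗Q _))) (cong toℕ (P≗Q _))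

degree-++ : ∀ {g m} (P : WordSet (g + m)) (w : Word g) (y : Word m) →
  degree P (w ++ y) ≡ degree (λ w′ → P (w′ ++ y)) w + degree (λ y′ → P (w ++ y′)) y
degree-++ P []      y = refl
degree-++ P (a ∷ w) y =
  trans (cong (λ d → d + A₁ + A₂) (degree-++ (λ x → P (a ∷ x)) w y))
        (shuffle (degree (λ w′ → P (a ∷ w′ ++ y)) w) (degree (λ y′ → P (a ∷ w ++ y′)) y) A₁ A₂)
  where
  A₁ = toℕ (P (a ⊕ 1F ∷ w ++ y))
  A₂ = toℕ (P (a ⊕ 2F ∷ w ++ y))
  shuffle : ∀ s t u v → s + t + u + v ≡ s + u + v + t
  shuffle = solve-∀

degree-residue : ∀ {n} (Q : Fin 3 → Bool) (v : Word n) →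
  degree (Q ∘ residue) v ≡ n * shiftsInto Q (residue v)
degree-residue Q [] = refl
degree-residue {suc n} Q (a ∷ v) = begin
  degree ((Q ∘ (a ⊕_)) ∘ residue) v + toℕ (Q (a ⊕ 1F ⊕ σ)) + toℕ (Q (a ⊕ 2F ⊕ σ))
    ≡⟨ cong₂ _+_ (cong₂ _+_ (degree-residue (Q ∘ (a ⊕_)) v) (cong (toℕ ∘ Q) (⊕-shift a 1F σ)))
                 (cong (toℕ ∘ Q) (⊕-shift a 2F σ)) ⟩
  n * shiftsInto (Q ∘ (a ⊕_)) σ + toℕ (Q (a ⊕ (σ ⊕ 1F))) + toℕ (Q (a ⊕ (σ ⊕ 2F)))
    ≡⟨ one-more n _ _ ⟩
  suc n * shiftsInto (Q ∘ (a ⊕_)) σ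
    ≡⟨ cong (suc n *_) (shiftsInto-translate Q a σ) ⟩
  suc n * shiftsInto Q (a ⊕ σ) ∎
  where
  open ≡-Reasoning
  σ = residue v
  one-more : ∀ n s t → n * (s + t) + s + t ≡ suc n * (s + t)
  one-more = solve-∀

degree-∘zeroSum : ∀ {n} (q : Bool → Bool) (v : Word n) →
  degree (q ∘ zeroSum) v ≡
    n * (if zeroSum v then toℕ (q false) + toℕ (q false) else toℕ (q true) + toℕ (q false))
degree-∘zeroSum {n} q v =
  trans (degree-residue (q ∘ isZero) v) (cong (n *_) (shiftsInto-isZero q (residue v)))

degree-zeroSum : ∀ {n} (v : Word n) → zeroSum v ≡ true → degree zeroSum v ≡ 0
degree-zeroSum {n} v v∈I = begin
  degree (id ∘ zeroSum) v                 ≡⟨ degree-∘zeroSum id v ⟩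
  n * (if zeroSum v then 0 else 1)        ≡⟨ cong (λ b → n * (if b then 0 else 1)) v∈I ⟩
  n * 0                                   ≡⟨ *-zeroʳ n ⟩
  0                                       ∎
  where open ≡-Reasoning

degree-nonZeroSum : ∀ {n} (v : Word n) → nonZeroSum v ≡ true → degree nonZeroSum v ≡ n
degree-nonZeroSum {n} v v∉I = begin
  degree (not ∘ zeroSum) v                ≡⟨ degree-∘zeroSum not v ⟩
  n * (if zeroSum v then 2 else 1)        ≡⟨ cong (λ b → n * (if b then 2 else 1)) (not-injective v∉I) ⟩
  n * 1                                   ≡⟨ *-identityʳ n ⟩
  n                                       ∎
  where open ≡-Reasoning

sumWords-zero : ∀ n → sumWords n (λ _ → 0) ≡ 0
sumWords-zero n = trans (sumWords-const n 0) (*-zeroʳ (3 ^ n))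

sumWords-point : ∀ {n} (v : Word n) (P : WordSet n) →
  sumWords n (λ y → toℕ ((dist v y ≡ᵇ 0) ∧ P y)) ≡ toℕ (P v)
sumWords-point []              P = refl
sumWords-point {suc n} (a ∷ v) P = begin
  ∑₃ H
    ≡⟨ ∑₃-from a H ⟩
  H a + H (a ⊕ 1F) + H (a ⊕ 2F)
    ≡⟨ cong₂ _+_ (cong₂ _+_ at-a (off 1F refl)) (off 2F refl) ⟩
  toℕ (P (a ∷ v)) + 0 + 0
    ≡⟨ trans (+-identityʳ _) (+-identityʳ _) ⟩
  toℕ (P (a ∷ v)) ∎
  where
  open ≡-Reasoning
  H : Fin 3 → ℕ
  H b = sumWords n (λ y → toℕ ((dist (a ∷ v) (b ∷ y) ≡ᵇ 0) ∧ P (b ∷ y)))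
  at-a : H a ≡ toℕ (P (a ∷ v))
  at-a = trans (sumWords-cong n λ y → cong (λ d → toℕ ((d ≡ᵇ 0) ∧ P (a ∷ y))) (dist-∷-same a v y))
               (sumWords-point v (λ y → P (a ∷ y)))
  off : ∀ k → isZero k ≡ false → H (a ⊕ k) ≡ 0
  off k k≢0 = trans (sumWords-cong n λ y → cong (λ d → toℕ ((d ≡ᵇ 0) ∧ P (a ⊕ k ∷ y)))
                                              (dist-∷-≢ (a≢a⊕k a k k≢0)))
                    (sumWords-zero n)

count-adjacent : ∀ {n} (P : WordSet n) (v : Word n) →
  sumWords n (λ y → toℕ (does (adj? v y) ∧ P y)) ≡ degree P v
count-adjacent         P []      = refl
count-adjacent {suc n} P (a ∷ v) = begin
  ∑₃ H
    ≡⟨ ∑₃-from a H ⟩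
  H a + H (a ⊕ 1F) + H (a ⊕ 2F)
    ≡⟨ cong₂ _+_ (cong₂ _+_ at-a (off 1F refl)) (off 2F refl) ⟩
  degree (λ y → P (a ∷ y)) v + toℕ (P (a ⊕ 1F ∷ v)) + toℕ (P (a ⊕ 2F ∷ v)) ∎
  where
  open ≡-Reasoning
  H : Fin 3 → ℕ
  H b = sumWords n (λ y → toℕ ((dist (a ∷ v) (b ∷ y) ≡ᵇ 1) ∧ P (b ∷ y)))
  at-a : H a ≡ degree (λ y → P (a ∷ y)) v
  at-a = trans (sumWords-cong n λ y → cong (λ d → toℕ ((d ≡ᵇ 1) ∧ P (a ∷ y))) (dist-∷-same a v y))
               (count-adjacent (λ y → P (a ∷ y)) v)
  off : ∀ k → isZero k ≡ false → H (a ⊕ k) ≡ toℕ (P (a ⊕ k ∷ v))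
  off k k≢0 = trans (sumWords-cong n λ y → cong (λ d → toℕ ((d ≡ᵇ 1) ∧ P (a ⊕ k ∷ y)))
                                              (dist-∷-≢ (a≢a⊕k a k k≢0)))
                    (sumWords-point v (λ y → P (a ⊕ k ∷ y)))

allWords : ∀ n → List (Word n)
allWords zero    = [ [] ]
allWords (suc n) = cartesianProductWith _∷_ (allFin 3) (allWords n)

∈-allWords : ∀ {n} (x : Word n) → x ∈ allWords n
∈-allWords []      = here refl
∈-allWords (a ∷ x) = ∈-cartesianProductWith⁺ _∷_ (∈-allFin a) (∈-allWords x)

allWords-unique : ∀ n → Unique (allWords n)
allWords-unique zero    = All.[] ∷ []
allWords-unique (suc n) =
  Unique.cartesianProductWith⁺ _∷_ ∷-injective (Unique.allFin⁺ 3) (allWords-unique n)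

sum-map-allWords : ∀ n (f : Word n → ℕ) → sum (map f (allWords n)) ≡ sumWords n f
sum-map-allWords zero    f = +-identityʳ (f [])
sum-map-allWords (suc n) f = begin
  sum (map f (cartesianProductWith _∷_ (allFin 3) (allWords n)))
    ≡⟨ sum-map-cartesianProductWith _∷_ f (allFin 3) (allWords n) ⟩
  h 0F + (h 1F + (h 2F + 0))
    ≡⟨ sum-of-three (h 0F) (h 1F) (h 2F) ⟩
  ∑₃ h
    ≡⟨ ∑₃-cong (λ a → sum-map-allWords n (λ y → f (a ∷ y))) ⟩
  sumWords (suc n) f ∎
  where
  open ≡-Reasoning
  h : Fin 3 → ℕ
  h a = sum (map (λ y → f (a ∷ y)) (allWords n))
  sum-of-three : ∀ x y z → x + (y + (z + 0)) ≡ x + y + z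
  sum-of-three = solve-∀

toList : ∀ {n} → WordSet n → List (Word n)
toList {n} P = filterᵇ P (allWords n)

toList-unique : ∀ {n} (P : WordSet n) → Unique (toList P)
toList-unique {n} P = Unique.filter⁺ _ (allWords-unique n)

∈-toList⁻ : ∀ {n} (P : WordSet n) {x} → x ∈ toList P → P x ≡ true
∈-toList⁻ {n} P x∈P = Equivalence.to T-≡ (proj₂ (∈-filter⁻ _ {xs = allWords n} x∈P))

length-toList : ∀ {n} (P : WordSet n) → length (toList P) ≡ count P
length-toList {n} P = trans (length-filterᵇ P (allWords n)) (sum-map-allWords n (toℕ ∘ P))

degIn-toList : ∀ {n} (P : WordSet n) v → degIn (toList P) v ≡ degree P v
degIn-toList {n} P v = begin
  length (filter (adj? v) (filterᵇ P (allWords n)))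
    ≡⟨ length-filter-filterᵇ {R = Adj v} (adj? v) P (allWords n) ⟩
  sum (map (λ y → toℕ (does (adj? v y) ∧ P y)) (allWords n))
    ≡⟨ sum-map-allWords n _ ⟩
  sumWords n (λ y → toℕ (does (adj? v y) ∧ P y))
    ≡⟨ count-adjacent P v ⟩
  degree P v ∎
  where open ≡-Reasoning

length-allWords : ∀ n → length (allWords n) ≡ 3 ^ n
length-allWords n = begin
  length (allWords n)
    ≡⟨ cong length (sym (filter-all (T? ∘ λ _ → true) (All.universal (λ _ → tt) (allWords n)))) ⟩
  length (toList {n} (λ _ → true))
    ≡⟨ length-toList {n} (λ _ → true) ⟩
  sumWords n (λ _ → 1)
    ≡⟨ sumWords-const n 1 ⟩
  3 ^ n * 1
    ≡⟨ *-identityʳ (3 ^ n) ⟩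
  3 ^ n ∎
  where open ≡-Reasoning

-- The zero-sum class is a maximum independent set

zeroSum-independent : ∀ {n} → IsIndependent (toList (zeroSum {n}))
zeroSum-independent = toList-unique zeroSum , λ {x} {y} x∈I y∈I adj →
  adjacent⇒residue≢ x y adj
    (trans (isZero⇒≡0F (∈-toList⁻ zeroSum x∈I)) (sym (isZero⇒≡0F (∈-toList⁻ zeroSum y∈I))))

-- Words with a common tail are pairwise adjacent, so tail is injective on an independent set.
tails-unique : ∀ {n} {J : List (Word (suc n))} → IsIndependent J → Unique (map tail J)
tails-unique {J = []}    _                 = []
tails-unique {J = x ∷ J} (x∉J ∷ !J , indep) =
  All.map⁺ (All.tabulate λ y∈J sameTail →
    indep (here refl) (there y∈J) (sameTail⇒adjacent (All.lookup x∉J y∈J) sameTail))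
  ∷ tails-unique (!J , λ x∈J y∈J → indep (there x∈J) (there y∈J))

zeroSum-maximum : ∀ {n} → IsMaxIndependent (toList (zeroSum {suc n}))
zeroSum-maximum {n} = zeroSum-independent , λ J J-indep → begin
  length J                            ≡⟨ sym (length-map tail J) ⟩
  length (map tail J)                 ≤⟨ unique⇒length≤ (tails-unique J-indep) (λ _ → ∈-allWords _) ⟩
  length (allWords n)                 ≡⟨ length-allWords n ⟩
  3 ^ n                               ≡⟨ sym (count-zeroSum n) ⟩
  count (zeroSum {suc n})             ≡⟨ sym (length-toList (zeroSum {suc n})) ⟩
  length (toList (zeroSum {suc n}))   ∎
  where open ≤-Reasoning

-- Gluing

Avoids : ∀ {n} → WordSet n → Set
Avoids S = ∀ x → S x ≡ true → zeroSum x ≡ true → ⊥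

fibre : ∀ {m} → WordSet m → Bool → WordSet m
fibre S b y = if b then S y else zeroSum y

-- glue g S = (I × S) ∪ (Iᶜ × I) ⊆ ℤ₃^g × ℤ₃^m, where I is the zero-sum class.
glue : ∀ g {m} → WordSet m → WordSet (g + m)
glue g {m} S x = fibre S (zeroSum (take g {m} x)) (drop g {m} x)

glue-++ : ∀ {g m} (S : WordSet m) (w : Word g) (y : Word m) →
  glue g S (w ++ y) ≡ fibre S (zeroSum w) y
glue-++ S w y = cong₂ (λ w′ → fibre S (zeroSum w′)) (take-++ w y) (drop-++ w y)

glue-avoids : ∀ {g m} {S : WordSet m} → Avoids S → Avoids (glue g S)
glue-avoids {g} {m} {S} S-avoids = ++-elim g {m} _ λ w y w++y∈U w++y∈I →
  both-or-neither w y (trans (sym (glue-++ S w y)) w++y∈U)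
    (isZero-⊕ (residue w) (residue y) (trans (cong isZero (sym (residue-++ w y))) w++y∈I))
  where
  both-or-neither : ∀ w y → fibre S (zeroSum w) y ≡ true → zeroSum w ≡ zeroSum y → ⊥
  both-or-neither w y with zeroSum w
  ... | true  = λ y∈S w~y → S-avoids y y∈S (sym w~y)
  ... | false = λ y∈I w~y → contradiction (trans w~y y∈I) λ ()

degree-glue : ∀ {g m} (S : WordSet m) (w : Word g) (y : Word m) →
  degree (glue g S) (w ++ y) ≡
    g * (if zeroSum w then toℕ (zeroSum y) + toℕ (zeroSum y) else toℕ (S y) + toℕ (zeroSum y))
    + degree (fibre S (zeroSum w)) y
degree-glue {g} S w y = begin
  degree (glue g S) (w ++ y)
    ≡⟨ degree-++ (glue g S) w y ⟩
  degree (λ w′ → glue g S (w′ ++ y)) w + degree (λ y′ → glue g S (w ++ y′)) y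
    ≡⟨ cong₂ _+_ (degree-cong (λ w′ → glue-++ S w′ y) w) (degree-cong (glue-++ S w) y) ⟩
  degree ((λ b → fibre S b y) ∘ zeroSum) w + degree (fibre S (zeroSum w)) y
    ≡⟨ cong (_+ degree (fibre S (zeroSum w)) y) (degree-∘zeroSum (λ b → fibre S b y) w) ⟩
  g * (if zeroSum w then toℕ (zeroSum y) + toℕ (zeroSum y) else toℕ (S y) + toℕ (zeroSum y))
    + degree (fibre S (zeroSum w)) y ∎
  where open ≡-Reasoning

glue-maxDegree : ∀ {g m D} {S : WordSet m} → g ≤ D → Avoids S → MaxDegree D S →
  MaxDegree D (glue g S)
glue-maxDegree {g} {m} {D} {S} g≤D S-avoids S-maxDegree = ++-elim g {m} _ λ w y w++y∈U →
  subst (_≤ D) (sym (degree-glue S w y)) (bound w y (trans (sym (glue-++ S w y)) w++y∈U))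
  where
  open ≤-Reasoning
  bound : ∀ w y → fibre S (zeroSum w) y ≡ true →
    g * (if zeroSum w then toℕ (zeroSum y) + toℕ (zeroSum y) else toℕ (S y) + toℕ (zeroSum y))
    + degree (fibre S (zeroSum w)) y ≤ D
  bound w y with zeroSum w
  ... | true  = λ y∈S → begin
    g * (toℕ (zeroSum y) + toℕ (zeroSum y)) + degree S y
      ≡⟨ cong (λ b → g * (toℕ b + toℕ b) + degree S y) (¬-not (S-avoids y y∈S)) ⟩
    g * 0 + degree S y
      ≡⟨ cong (_+ degree S y) (*-zeroʳ g) ⟩
    degree S y
      ≤⟨ S-maxDegree y y∈S ⟩
    D ∎
  ... | false = λ y∈I → begin
    g * (toℕ (S y) + toℕ (zeroSum y)) + degree zeroSum y
      ≡⟨ cong₂ (λ s z → g * (toℕ s + toℕ z) + degree zeroSum y)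
               (¬-not (λ y∈S → S-avoids y y∈S y∈I)) y∈I ⟩
    g * 1 + degree zeroSum y
      ≡⟨ cong₂ _+_ (*-identityʳ g) (degree-zeroSum y y∈I) ⟩
    g + 0
      ≡⟨ +-identityʳ g ⟩
    g
      ≤⟨ g≤D ⟩
    D ∎

count-fibre : ∀ {m} (S : WordSet m) b →
  count (fibre S b) ≡ (if b then count S else count (zeroSum {m}))
count-fibre S true  = refl
count-fibre S false = refl

count-glue : ∀ g {m} (S : WordSet m) →
  count (glue g S) ≡ count (zeroSum {g}) * count S + count (nonZeroSum {g}) * count (zeroSum {m})
count-glue g {m} S = begin
  sumWords (g + m) (toℕ ∘ glue g S)
    ≡⟨ sumWords-++ g m _ ⟩
  sumWords g (λ w → sumWords m (λ y → toℕ (glue g S (w ++ y))))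
    ≡⟨ sumWords-cong g (λ w → sumWords-cong m (λ y → cong toℕ (glue-++ S w y))) ⟩
  sumWords g (λ w → count (fibre S (zeroSum w)))
    ≡⟨ sumWords-cong g (λ w → count-fibre S (zeroSum w)) ⟩
  sumWords g (λ w → if zeroSum w then count S else count (zeroSum {m}))
    ≡⟨ sumWords-if g zeroSum (count S) (count (zeroSum {m})) ⟩
  count (zeroSum {g}) * count S + count (nonZeroSum {g}) * count (zeroSum {m}) ∎
  where open ≡-Reasoning

record BoundedDegreeSet (D n e : ℕ) : Set where
  field
    set       : WordSet (suc n)
    avoids    : Avoids set
    maxDegree : MaxDegree D set
    large     : 3 ^ n + 3 ^ e ≤ count set

nonZeroSum-set : ∀ {D r} → suc r ≤ D → BoundedDegreeSet D r r
nonZeroSum-set {r = r} r<D = record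
  { set       = nonZeroSum
  ; avoids    = λ x x∉I x∈I → contradiction (trans (sym (cong not x∈I)) x∉I) λ ()
  ; maxDegree = λ x x∉I → ≤-trans (≤-reflexive (degree-nonZeroSum x x∉I)) r<D
  ; large     = ≤-reflexive (trans (double (3 ^ r)) (sym (count-nonZeroSum r)))
  }
  where
  double : ∀ x → x + x ≡ x * 2
  double = solve-∀

glue-set : ∀ {D g n e} → suc g ≤ D → BoundedDegreeSet D n e → BoundedDegreeSet D (g + suc n) (g + e)
glue-set {g = g} {n} {e} g<D B = record
  { set       = glue (suc g) set
  ; avoids    = glue-avoids {suc g} avoids
  ; maxDegree = glue-maxDegree g<D avoids maxDegree
  ; large     = begin
      3 ^ (g + suc n) + 3 ^ (g + e)
        ≡⟨ cong₂ _+_ (^-distribˡ-+-* 3 g (suc n)) (^-distribˡ-+-* 3 g e) ⟩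
      3 ^ g * (3 * 3 ^ n) + 3 ^ g * 3 ^ e
        ≡⟨ regroup (3 ^ g) (3 ^ n) (3 ^ e) ⟩
      3 ^ g * (3 ^ n + 3 ^ e) + 3 ^ g * 2 * 3 ^ n
        ≤⟨ +-monoˡ-≤ (3 ^ g * 2 * 3 ^ n) (*-monoʳ-≤ (3 ^ g) large) ⟩
      3 ^ g * count set + 3 ^ g * 2 * 3 ^ n
        ≡⟨ sym (cong₂ _+_ (cong (_* count set) (count-zeroSum g))
                         (cong₂ _*_ (count-nonZeroSum g) (count-zeroSum n))) ⟩
      count (zeroSum {suc g}) * count set + count (nonZeroSum {suc g}) * count (zeroSum {suc n})
        ≡⟨ sym (count-glue (suc g) set) ⟩
      count (glue (suc g) set) ∎
  }
  where
  open BoundedDegreeSet B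
  open ≤-Reasoning
  regroup : ∀ p q r → p * (3 * q) + p * r ≡ p * (q + r) + p * 2 * q
  regroup = solve-∀

construction : ∀ {d r} → suc r ≤ suc d → ∀ j → BoundedDegreeSet (suc d) (j * suc d + r) (j * d + r)
construction r<d zero = nonZeroSum-set r<d
construction {d} {r} r<d (suc j) =
  subst₂ (BoundedDegreeSet (suc d)) (length-step d (j * suc d) r) (sym (+-assoc d (j * d) r))
    (glue-set ≤-refl (construction r<d j))
  where
  length-step : ∀ d k r → d + suc (k + r) ≡ suc d + k + r
  length-step = solve-∀

exponent-bound : ∀ d j r → (d * suc (j * suc d + r)) / suc d ≤ j * d + r
exponent-bound d j r = ≤-pred (m<n*o⇒m/o<n (begin-strict
  d * suc (j * suc d + r)            <⟨ m<n+m _ (s≤s z≤n) ⟩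
  suc r + d * suc (j * suc d + r)    ≡⟨ surplus d j r ⟩
  suc (j * d + r) * suc d            ∎))
  where
  open ≤-Reasoning
  surplus : ∀ d j r → suc r + d * suc (j * suc d + r) ≡ suc (j * d + r) * suc d
  surplus = solve-∀

fromBoundedDegreeSet : ∀ {D n e k} → BoundedDegreeSet D n e → k ≤ e →
  Σ (List (Word (suc n))) λ U →
    Unique U × MaxDegAtMost D U × (3 ^ n + 3 ^ k ≤ length U)
    × Σ (List (Word (suc n))) λ I → IsMaxIndependent I × Disjoint U I
fromBoundedDegreeSet {D} {n} {e} {k} B k≤e =
  toList set , toList-unique set , U-maxDegree , U-large , toList zeroSum , zeroSum-maximum , U∩I=∅
  where
  open BoundedDegreeSet B
  U-maxDegree : MaxDegAtMost D (toList set)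
  U-maxDegree = All.tabulate λ {v} v∈U →
    subst (_≤ D) (sym (degIn-toList set v)) (maxDegree v (∈-toList⁻ set v∈U))
  U-large : 3 ^ n + 3 ^ k ≤ length (toList set)
  U-large = ≤-trans (+-monoʳ-≤ (3 ^ n) (^-monoʳ-≤ 3 k≤e))
                    (subst (3 ^ n + 3 ^ e ≤_) (sym (length-toList set)) large)
  U∩I=∅ : Disjoint (toList set) (toList zeroSum)
  U∩I=∅ x∈U x∈I = avoids _ (∈-toList⁻ set x∈U) (∈-toList⁻ zeroSum x∈I)

lemma6p3 : (d n : ℕ) → .{{_ : NonZero d}} → .{{_ : NonZero n}} →
    Σ (List (Word n)) λ U →
      Unique U × MaxDegAtMost d U
      × (3 ^ (n ∸ 1) + 3 ^ (((d ∸ 1) * n) / d) ≤ length U)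
      × Σ (List (Word n)) λ I → IsMaxIndependent I × Disjoint U I
lemma6p3 (suc d) (suc n) = fromBoundedDegreeSet U small-exponent
  where
  j = n / suc d
  r = n % suc d
  n≡j*[1+d]+r : j * suc d + r ≡ n
  n≡j*[1+d]+r = trans (+-comm (j * suc d) r) (sym (m≡m%n+[m/n]*n n (suc d)))
  U : BoundedDegreeSet (suc d) n (j * d + r)
  U = subst (λ n′ → BoundedDegreeSet (suc d) n′ (j * d + r)) n≡j*[1+d]+r
        (construction (m%n<n n (suc d)) j)
  small-exponent : (d * suc n) / suc d ≤ j * d + r
  small-exponent = subst (λ n′ → (d * suc n′) / suc d ≤ j * d + r) n≡j*[1+d]+r
                     (exponent-bound d j r)
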